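{- Let $S_\infty$ be a set with subsets $S_1\subseteq S_2\subseteq\cdots$, $S_\infty=\bigcup_nS_n$, and let $((\mathrm{cl}_n)_{n\ge1},\mathrm{cl}_\infty)$ be a consistent system of closure operations. Let $\mathcal A=(A_n)_{n\ge1}$ be a $(\mathrm{cl}_n)$-closed chain with limit $A_\infty$ and saturation $\bar{\mathcal A}=(A_\infty\cap S_n)_{n\ge1}$. Then: (i) $A_\infty$ is $\mathrm{cl}_\infty$-closed if $\bar{\mathcal A}$ is eventually $(\mathrm{cl}_n)$-closed (i.e. $A_\infty\cap S_n$ is $\mathrm{cl}_n$-closed for all large $n$) or $\mathcal A$ is eventually saturated; (ii) if $A_\infty$ is $\mathrm{cl}_\infty$-closed, then $\bar{\mathcal A}$ is $(\mathrm{cl}_n)$-closed.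
   Context: A chain of sets is a sequence $(A_n)_{n\ge1}$ with $A_n\subseteq S_n$, $A_n\subseteq A_{n+1}$; limit $A_\infty=\bigcup_nA_n$; eventually saturated if $A_n=A_\infty\cap S_n$ for all large $n$. A closure operation on $X$: $A\mapsto A^{\mathrm{cl}}$ on subsets with $A\subseteq A^{\mathrm{cl}}$, $(A^{\mathrm{cl}})^{\mathrm{cl}}=A^{\mathrm{cl}}$, monotone; $A$ is closed if $A^{\mathrm{cl}}=A$. The system ($\mathrm{cl}_n$ on $S_n$, $\mathrm{cl}_\infty$ on $S_\infty$) is consistent if $(A\cap S_n)^{\mathrm{cl}_n}=A^{\mathrm{cl}_\infty}\cap S_n$ for all $n\ge1$ and $A\subseteq S_\infty$. A chain is $(\mathrm{cl}_n)$-closed if each $A_n$ is $\mathrm{cl}_n$-closed. -}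

module Defs where

open import Level using (Level; _⊔_)
open import Data.Nat using (ℕ; suc; _≥_)
open import Data.Product using (Σ; _×_)
open import Relation.Unary using (Pred; _⊆_; _≐_; _∩_)

-- Indexing: the paper's S_1, S_2, ... are  S 0, S 1, ...  (index shifted by one).

private
  variable
    a ℓ : Level
    X : Set a

⋃ₙ : (ℕ → Pred X ℓ) → Pred X ℓ
⋃ₙ F x = Σ ℕ (λ n → F n x)

-- a closure operation on the set D (a subset of the ambient carrier X):
-- defined on subsets of D, with values subsets of D
record IsClosureOp {X : Set a} (D : Pred X ℓ) (cl : Pred X ℓ → Pred X ℓ) : Set (a ⊔ Level.suc ℓ) where
  field
    cl-sub        : ∀ A → A ⊆ D → cl A ⊆ D
    cl-extensive  : ∀ A → A ⊆ D → A ⊆ cl A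
    cl-idempotent : ∀ A → A ⊆ D → cl (cl A) ≐ cl A
    cl-monotone   : ∀ A B → A ⊆ B → B ⊆ D → cl A ⊆ cl B

Closed : (Pred X ℓ → Pred X ℓ) → Pred X ℓ → Set _
Closed cl A = cl A ≐ A

Increasing : (ℕ → Pred X ℓ) → Set _
Increasing S = ∀ n → S n ⊆ S (suc n)

Consistent : (S : ℕ → Pred X ℓ) → (ℕ → Pred X ℓ → Pred X ℓ) → (Pred X ℓ → Pred X ℓ) → Set _
Consistent S cl clInf = ∀ n A → A ⊆ ⋃ₙ S → cl n (A ∩ S n) ≐ (clInf A ∩ S n)

IsChain : (S : ℕ → Pred X ℓ) → (ℕ → Pred X ℓ) → Set _
IsChain S A = (∀ n → A n ⊆ S n) × (∀ n → A n ⊆ A (suc n))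

limit : (ℕ → Pred X ℓ) → Pred X ℓ
limit A = ⋃ₙ A

saturation : (S : ℕ → Pred X ℓ) → (ℕ → Pred X ℓ) → ℕ → Pred X ℓ
saturation S A n = limit A ∩ S n

ChainClosed : (ℕ → Pred X ℓ → Pred X ℓ) → (ℕ → Pred X ℓ) → Set _
ChainClosed cl A = ∀ n → Closed (cl n) (A n)

EventuallyChainClosed : (ℕ → Pred X ℓ → Pred X ℓ) → (ℕ → Pred X ℓ) → Set _
EventuallyChainClosed cl A = Σ ℕ (λ N → ∀ n → n ≥ N → Closed (cl n) (A n))

EventuallySaturated : (S : ℕ → Pred X ℓ) → (ℕ → Pred X ℓ) → Set _
EventuallySaturated S A = Σ ℕ (λ N → ∀ n → n ≥ N → A n ≐ saturation S A n)

-- Every element of cl_∞(A_∞) lies in some S_m, and by consistency it then lies in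
-- cl_n(A_∞ ∩ S_n) for every n ≥ m. So A_∞ is closed as soon as cl_n(A_∞ ∩ S_n) ⊆ A_∞
-- for all large n; this holds if A_∞ ∩ S_n is cl_n-closed, and also if
-- A_n = A_∞ ∩ S_n, since then cl_n(A_∞ ∩ S_n) = cl_n(A_n) = A_n. Conversely, if A_∞
-- is closed, consistency gives cl_n(A_∞ ∩ S_n) = cl_∞(A_∞) ∩ S_n = A_∞ ∩ S_n.
module Submission where

open import Defs
open import Level using (Level)
open import Data.Nat using (ℕ; _+_; _≤_; _≥_; _≤′_; ≤′-refl; ≤′-step)
open import Data.Nat.Properties using (m≤m+n; m≤n+m; ≤⇒≤′)
open import Data.Product using (Σ; _×_; _,_; proj₁; proj₂)
open import Data.Sum using (_⊎_; inj₁; inj₂)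
open import Relation.Unary using (Pred; _⊆_; _∩_)
open import Function using (_∘_)

private
  variable
    a ℓ : Level
    X : Set a

Increasing⇒mono′ : {S : ℕ → Pred X ℓ} → Increasing S → ∀ {m n} → m ≤′ n → S m ⊆ S n
Increasing⇒mono′ inc ≤′-refl           = λ x → x
Increasing⇒mono′ inc (≤′-step {n} m≤n) = inc n ∘ Increasing⇒mono′ inc m≤n

Increasing⇒mono : {S : ℕ → Pred X ℓ} → Increasing S → ∀ {m n} → m ≤ n → S m ⊆ S n
Increasing⇒mono inc = Increasing⇒mono′ inc ∘ ≤⇒≤′

limit⊆⋃ₙ : {S A : ℕ → Pred X ℓ} → IsChain S A → limit A ⊆ ⋃ₙ S
limit⊆⋃ₙ (A⊆S , _) (n , x∈Aₙ) = n , A⊆S n x∈Aₙ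

closed-superset⇒cl⊆ : {D A B : Pred X ℓ} {cl : Pred X ℓ → Pred X ℓ} → IsClosureOp D cl →
                      A ⊆ D → Closed cl A → B ⊆ A → cl B ⊆ A
closed-superset⇒cl⊆ clOp A⊆D (clA⊆A , _) B⊆A = clA⊆A ∘ IsClosureOp.cl-monotone clOp _ _ B⊆A A⊆D

module _ {S : ℕ → Pred X ℓ} (cl : ℕ → Pred X ℓ → Pred X ℓ) {clInf : Pred X ℓ → Pred X ℓ}
         (inc : Increasing S) (clInfOp : IsClosureOp (⋃ₙ S) clInf)
         (cons : Consistent S cl clInf) {B : Pred X ℓ} (B⊆S : B ⊆ ⋃ₙ S) where

  closed-if-eventually-cl⊆ : Σ ℕ (λ N → ∀ n → n ≥ N → cl n (B ∩ S n) ⊆ B) → Closed clInf B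
  closed-if-eventually-cl⊆ (N , clₙ⊆B) = clInf⊆B , cl-extensive B B⊆S
    where
    open IsClosureOp clInfOp
    clInf⊆B : clInf B ⊆ B
    clInf⊆B x∈cl with m , x∈Sₘ ← cl-sub B B⊆S x∈cl =
      clₙ⊆B (N + m) (m≤m+n N m)
        (proj₂ (cons (N + m) B B⊆S) (x∈cl , Increasing⇒mono inc (m≤n+m m N) x∈Sₘ))

  closed⇒traces-closed : Closed clInf B → ∀ n → Closed (cl n) (B ∩ S n)
  closed⇒traces-closed (clB⊆B , B⊆clB) n =
    (λ x∈cl → let x∈clB , x∈Sₙ = proj₁ (cons n B B⊆S) x∈cl in clB⊆B x∈clB , x∈Sₙ) ,
    (λ (x∈B , x∈Sₙ) → proj₂ (cons n B B⊆S) (B⊆clB x∈B , x∈Sₙ))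

lemma2p6 : ∀ {a ℓ : Level} {X : Set a}
    (S : ℕ → Pred X ℓ) (cl : ℕ → Pred X ℓ → Pred X ℓ) (clInf : Pred X ℓ → Pred X ℓ) →
    Increasing S →
    (∀ n → IsClosureOp (S n) (cl n)) →
    IsClosureOp (⋃ₙ S) clInf →
    Consistent S cl clInf →
    (A : ℕ → Pred X ℓ) → IsChain S A → ChainClosed cl A →
    ((EventuallyChainClosed cl (saturation S A) ⊎ EventuallySaturated S A) → Closed clInf (limit A))
    × (Closed clInf (limit A) → ChainClosed cl (saturation S A))
lemma2p6 S cl clInf inc clOp clInfOp cons A chain@(A⊆S , _) Acl =
  closed-if-eventually-cl⊆ cl inc clInfOp cons L⊆S ∘ eventually-cl⊆ ,
  closed⇒traces-closed cl inc clInfOp cons L⊆S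
  where
  L⊆S : limit A ⊆ ⋃ₙ S
  L⊆S = limit⊆⋃ₙ chain
  eventually-cl⊆ : EventuallyChainClosed cl (saturation S A) ⊎ EventuallySaturated S A →
                   Σ ℕ (λ N → ∀ n → n ≥ N → cl n (saturation S A n) ⊆ limit A)
  eventually-cl⊆ (inj₁ (N , satClosed)) = N , λ n n≥N → proj₁ ∘ proj₁ (satClosed n n≥N)
  eventually-cl⊆ (inj₂ (N , saturated)) = N , λ n n≥N →
    (n ,_) ∘ closed-superset⇒cl⊆ (clOp n) (A⊆S n) (Acl n) (proj₂ (saturated n n≥N))
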